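{- Let $a_n$, $s$ and $c$ be any integers and let $n$ be a positive integer. Then \[ \sum_{a_{n-1}=c}^{a_n}\sum_{a_{n-2}=c}^{a_{n-1}}\cdots\sum_{a_0=c}^{a_1}(-1)^{a_0}F_{3a_0+s}=(-1)^{a_n}\frac{F_{n+3a_n+s}}{2^n}+(-1)^c\sum_{j=0}^{n-1}\frac{F_{n-j+3(c-1)+s}}{2^{n-j}}\binom{a_n+j-c}{j}, \] and \[ \sum_{a_{n-1}=c}^{a_n}\sum_{a_{n-2}=c}^{a_{n-1}}\cdots\sum_{a_0=c}^{a_1}(-1)^{a_0}L_{3a_0+s}=(-1)^{a_n}\frac{L_{n+3a_n+s}}{2^n}+(-1)^c\sum_{j=0}^{n-1}\frac{L_{n-j+3(c-1)+s}}{2^{n-j}}\binom{a_n+j-c}{j}. \]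
   Context: $F_j$ and $L_j$ are the Fibonacci and Lucas numbers: $F_0=0$, $F_1=1$, $L_0=2$, $L_1=1$, and both satisfy $X_j=X_{j-1}+X_{j-2}$, extended to all integer indices by this recurrence. The left sides are iterated sums with $n$ summation signs: $a_{n-1}$ runs from $c$ to $a_n$, and for each $i$ the index $a_{i-1}$ runs from $c$ to $a_i$. Summation convention: for integers $m,M$, $\sum_{k=m}^{M}h(k)$ is the usual sum if $M\ge m$, equals $0$ if $M=m-1$, and equals $-\sum_{k=M+1}^{m-1}h(k)$ if $M\le m-2$. For an integer $N$ and a non-negative integer $j$, $\binom{N}{j}=N(N-1)\cdots(N-j+1)/j!$. -}

module Defs where

open import Data.Nat as ℕ using (ℕ; zero; suc)
open import Data.Integer as ℤ using (ℤ; +_; -[1+_])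
open import Data.Rational as ℚ using (ℚ)
open import Data.Nat.Properties as ℕP using (m^n≢0)
open import Data.Nat.Base using (_!)
open import Data.Nat.Properties using (_!≢0)

fibℕ : ℕ → ℤ
fibℕ zero = + 0
fibℕ (suc zero) = + 1
fibℕ (suc (suc n)) = fibℕ (suc n) ℤ.+ fibℕ n

lucℕ : ℕ → ℤ
lucℕ zero = + 2
lucℕ (suc zero) = + 1
lucℕ (suc (suc n)) = lucℕ (suc n) ℤ.+ lucℕ n

-- Extension to negative indices forced by X_j = X_{j-1} + X_{j-2}:
-- F_{-k} = (-1)^{k+1} F_k and L_{-k} = (-1)^k L_k.
sgn : ℕ → ℤ
sgn zero = + 1
sgn (suc k) = ℤ.- sgn k

F : ℤ → ℤ
F (+ k) = fibℕ k
F -[1+ k ] = sgn k ℤ.* fibℕ (suc k)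

L : ℤ → ℤ
L (+ k) = lucℕ k
L -[1+ k ] = ℤ.- (sgn k) ℤ.* lucℕ (suc k)

negOnePow : ℤ → ℤ
negOnePow (+ k) = sgn k
negOnePow -[1+ k ] = sgn (suc k)

sumFrom : ℤ → ℕ → (ℤ → ℚ) → ℚ
sumFrom m zero h = ℚ.0ℚ
sumFrom m (suc len) h = h m ℚ.+ sumFrom (m ℤ.+ + 1) len h

-- Σ_{k=m}^{M} h k with the stated convention for M < m
Σ[_⋯_] : ℤ → ℤ → (ℤ → ℚ) → ℚ
Σ[ m ⋯ M ] h with M ℤ.- m ℤ.+ + 1
... | + len = sumFrom m len h
... | -[1+ k ] = ℚ.- sumFrom (M ℤ.+ + 1) (suc k) h

sumℕ : ℕ → (ℕ → ℚ) → ℚ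
sumℕ zero g = ℚ.0ℚ
sumℕ (suc len) g = sumℕ len g ℚ.+ g len

fallingℤ : ℤ → ℕ → ℤ
fallingℤ N zero = + 1
fallingℤ N (suc j) = fallingℤ N j ℤ.* (N ℤ.- + j)

binom : ℤ → ℕ → ℚ
binom N j = (fallingℤ N j ℚ./ (j !)) {{j !≢0}}

-- iterated sum with n summation signs, lower limit c, upper limit a_n = a
iterSum : (ℤ → ℚ) → ℤ → ℕ → ℤ → ℚ
iterSum f c zero a = f a
iterSum f c (suc n) a = Σ[ c ⋯ a ] (λ b → iterSum f c n b)

ι : ℤ → ℚ
ι z = z ℚ./ 1

_/ℕ_ : ℚ → (d : ℕ) → .{{ℕ.NonZero d}} → ℚ
q /ℕ d = q ℚ.* (+ 1 ℚ./ d)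

_/2^_ : ℚ → ℕ → ℚ
q /2^ n = (q /ℕ (2 ℕ.^ n)) {{m^n≢0 2 n}}

{-# OPTIONS --safe #-}
-- Every layer of the iterated sum telescopes. For a sequence X with X(k+2) = X(k+1) + X(k) one has
-- X(k+3) + X(k) = 2 X(k+2), so (-1)^b X(m+3b+s) / 2^m is the backward difference in b of
-- (-1)^b X(m+1+3b+s) / 2^(m+1); by Pascal's rule, binom(b+j-c, j) is the backward difference of
-- binom(b+j+1-c, j+1). Hence the right-hand side for n is a backward difference, and evaluating its
-- antidifference between c-1 and a gives the right-hand side for n+1: at c-1 the new binomials vanish
-- and the leading term supplies the new j = 0 coefficient.
module Submission where

open import Data.Nat as ℕ using (ℕ; zero; suc; _∸_; _!)
import Data.Nat.Properties as ℕP
open import Data.Nat.Properties using (_!≢0; m*n≢0; m^n≢0)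
open import Data.Integer as ℤ using (ℤ; +_; -[1+_])
import Data.Integer.Properties as ℤP
open import Data.Integer.Tactic.RingSolver using (solve-∀)
open import Data.Rational as ℚ using (ℚ)
import Data.Rational.Properties as ℚP
open import Data.Rational.Solver using (module +-*-Solver)
open import Data.Rational.Unnormalised as ℚᵘ using (mkℚᵘ; *≡*)
import Data.Rational.Unnormalised.Properties as ℚᵘP
open import Data.Product using (_×_; _,_)
open import Relation.Binary.PropositionalEquality

open import Defs

open +-*-Solver using (solve; _:+_; _:*_; _:-_; :-_; _:=_; con)

toℚᵘ-/ : ∀ p k → ℚ.toℚᵘ (p ℚ./ suc k) ℚᵘ.≃ mkℚᵘ p k
toℚᵘ-/ p k = ℚP.toℚᵘ-fromℚᵘ (mkℚᵘ p k)

ι-+ : ∀ x y → ι (x ℤ.+ y) ≡ ι x ℚ.+ ι y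
ι-+ x y = ℚP.toℚᵘ-injective (begin
  ℚ.toℚᵘ (ι (x ℤ.+ y))             ≈⟨ toℚᵘ-/ (x ℤ.+ y) 0 ⟩
  mkℚᵘ (x ℤ.+ y) 0                 ≈⟨ *≡* (numerators x y) ⟩
  mkℚᵘ x 0 ℚᵘ.+ mkℚᵘ y 0           ≈⟨ ℚᵘP.+-cong (toℚᵘ-/ x 0) (toℚᵘ-/ y 0) ⟨
  ℚ.toℚᵘ (ι x) ℚᵘ.+ ℚ.toℚᵘ (ι y)   ≈⟨ ℚP.toℚᵘ-homo-+ (ι x) (ι y) ⟨
  ℚ.toℚᵘ (ι x ℚ.+ ι y)             ∎)
  where
  open ℚᵘP.≃-Reasoning
  numerators : ∀ x y → (x ℤ.+ y) ℤ.* + 1 ≡ (x ℤ.* + 1 ℤ.+ y ℤ.* + 1) ℤ.* + 1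
  numerators = solve-∀

ι-* : ∀ x y → ι (x ℤ.* y) ≡ ι x ℚ.* ι y
ι-* x y = ℚP.toℚᵘ-injective (begin
  ℚ.toℚᵘ (ι (x ℤ.* y))             ≈⟨ toℚᵘ-/ (x ℤ.* y) 0 ⟩
  mkℚᵘ x 0 ℚᵘ.* mkℚᵘ y 0           ≈⟨ ℚᵘP.*-cong (toℚᵘ-/ x 0) (toℚᵘ-/ y 0) ⟨
  ℚ.toℚᵘ (ι x) ℚᵘ.* ℚ.toℚᵘ (ι y)   ≈⟨ ℚP.toℚᵘ-homo-* (ι x) (ι y) ⟨
  ℚ.toℚᵘ (ι x ℚ.* ι y)             ∎)
  where open ℚᵘP.≃-Reasoning

ι-neg : ∀ x → ι (ℤ.- x) ≡ ℚ.- ι x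
ι-neg x = ℚP.toℚᵘ-injective (begin
  ℚ.toℚᵘ (ι (ℤ.- x))     ≈⟨ toℚᵘ-/ (ℤ.- x) 0 ⟩
  ℚᵘ.- mkℚᵘ x 0          ≈⟨ ℚᵘP.-‿cong (toℚᵘ-/ x 0) ⟨
  ℚᵘ.- ℚ.toℚᵘ (ι x)      ≈⟨ ℚP.toℚᵘ-homo‿- (ι x) ⟨
  ℚ.toℚᵘ (ℚ.- ι x)       ∎)
  where open ℚᵘP.≃-Reasoning

ι-- : ∀ x y → ι (x ℤ.- y) ≡ ι x ℚ.- ι y
ι-- x y = trans (ι-+ x (ℤ.- y)) (cong (ι x ℚ.+_) (ι-neg y))

ι-/ℕ : ∀ z d .{{_ : ℕ.NonZero d}} → ι z /ℕ d ≡ z ℚ./ d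
ι-/ℕ z (suc k) = ℚP.toℚᵘ-injective (begin
  ℚ.toℚᵘ (ι z ℚ.* (+ 1 ℚ./ suc k))            ≈⟨ ℚP.toℚᵘ-homo-* (ι z) (+ 1 ℚ./ suc k) ⟩
  ℚ.toℚᵘ (ι z) ℚᵘ.* ℚ.toℚᵘ (+ 1 ℚ./ suc k)    ≈⟨ ℚᵘP.*-cong (toℚᵘ-/ z 0) (toℚᵘ-/ (+ 1) k) ⟩
  mkℚᵘ z 0 ℚᵘ.* mkℚᵘ (+ 1) k                  ≈⟨ *≡* (cong₂ (λ m e → m ℤ.* + suc e) (ℤP.*-identityʳ z) (sym (ℕP.+-identityʳ k))) ⟩
  mkℚᵘ z k                                    ≈⟨ toℚᵘ-/ z k ⟨
  ℚ.toℚᵘ (z ℚ./ suc k)                        ∎)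
  where open ℚᵘP.≃-Reasoning

1/[m*n]≡1/m*1/n : ∀ m n .{{_ : ℕ.NonZero m}} .{{_ : ℕ.NonZero n}} →
  (+ 1 ℚ./ (m ℕ.* n)) {{m*n≢0 m n}} ≡ (+ 1 ℚ./ m) ℚ.* (+ 1 ℚ./ n)
1/[m*n]≡1/m*1/n (suc i) (suc j) = ℚP.toℚᵘ-injective (begin
  ℚ.toℚᵘ (+ 1 ℚ./ (suc i ℕ.* suc j))                  ≈⟨ toℚᵘ-/ (+ 1) (j ℕ.+ i ℕ.* suc j) ⟩
  mkℚᵘ (+ 1) i ℚᵘ.* mkℚᵘ (+ 1) j                       ≈⟨ ℚᵘP.*-cong (toℚᵘ-/ (+ 1) i) (toℚᵘ-/ (+ 1) j) ⟨
  ℚ.toℚᵘ (+ 1 ℚ./ suc i) ℚᵘ.* ℚ.toℚᵘ (+ 1 ℚ./ suc j)  ≈⟨ ℚP.toℚᵘ-homo-* (+ 1 ℚ./ suc i) (+ 1 ℚ./ suc j) ⟨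
  ℚ.toℚᵘ ((+ 1 ℚ./ suc i) ℚ.* (+ 1 ℚ./ suc j))        ∎)
  where open ℚᵘP.≃-Reasoning

n/n≡1 : ∀ n .{{_ : ℕ.NonZero n}} → + n ℚ./ n ≡ ℚ.1ℚ
n/n≡1 (suc k) = ℚP.toℚᵘ-injective (ℚᵘP.≃-trans (toℚᵘ-/ (+ suc k) k) (*≡* (ℤP.*-comm (+ suc k) (+ 1))))

*-/ℕ-cancelˡ : ∀ m n q .{{_ : ℕ.NonZero m}} .{{_ : ℕ.NonZero n}} →
  ((ι (+ m) ℚ.* q) /ℕ (m ℕ.* n)) {{m*n≢0 m n}} ≡ q /ℕ n
*-/ℕ-cancelˡ m n q = begin
  (ι (+ m) ℚ.* q) ℚ.* (+ 1 ℚ./ (m ℕ.* n)) {{m*n≢0 m n}}    ≡⟨ cong ((ι (+ m) ℚ.* q) ℚ.*_) (1/[m*n]≡1/m*1/n m n) ⟩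
  (ι (+ m) ℚ.* q) ℚ.* ((+ 1 ℚ./ m) ℚ.* (+ 1 ℚ./ n))       ≡⟨ regroup (ι (+ m)) q (+ 1 ℚ./ m) (+ 1 ℚ./ n) ⟩
  (ι (+ m) /ℕ m) ℚ.* (q /ℕ n)                             ≡⟨ cong (ℚ._* (q /ℕ n)) (trans (ι-/ℕ (+ m) m) (n/n≡1 m)) ⟩
  ℚ.1ℚ ℚ.* (q /ℕ n)                                       ≡⟨ ℚP.*-identityˡ (q /ℕ n) ⟩
  q /ℕ n                                                  ∎
  where
  open ≡-Reasoning
  regroup : ∀ a q x y → (a ℚ.* q) ℚ.* (x ℚ.* y) ≡ (a ℚ.* x) ℚ.* (q ℚ.* y)
  regroup = solve 4 (λ a q x y → (a :* q) :* (x :* y) := (a :* x) :* (q :* y)) refl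

ι-sub-/ℕ : ∀ x y d .{{_ : ℕ.NonZero d}} → ι x /ℕ d ℚ.- ι y /ℕ d ≡ ι (x ℤ.- y) /ℕ d
ι-sub-/ℕ x y d = begin
  ι x ℚ.* r ℚ.- ι y ℚ.* r    ≡⟨ factor (ι x) (ι y) r ⟩
  (ι x ℚ.- ι y) ℚ.* r        ≡⟨ cong (ℚ._* r) (ι-- x y) ⟨
  ι (x ℤ.- y) ℚ.* r          ∎
  where
  open ≡-Reasoning
  r = + 1 ℚ./ d
  factor : ∀ a b r → a ℚ.* r ℚ.- b ℚ.* r ≡ (a ℚ.- b) ℚ.* r
  factor = solve 3 (λ a b r → a :* r :- b :* r := (a :- b) :* r) refl

/2^-suc : ∀ q n → q /2^ n ≡ (q ℚ.+ q) /2^ suc n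
/2^-suc q n = begin
  q /2^ n
    ≡⟨ *-/ℕ-cancelˡ 2 (2 ℕ.^ n) q {{_}} {{m^n≢0 2 n}} ⟨
  ((ι (+ 2) ℚ.* q) /ℕ (2 ℕ.* 2 ℕ.^ n)) {{m^n≢0 2 (suc n)}}
    ≡⟨ cong (λ p → (p /ℕ (2 ℕ.^ suc n)) {{m^n≢0 2 (suc n)}}) (double q) ⟨
  (q ℚ.+ q) /2^ suc n ∎
  where
  open ≡-Reasoning
  double : ∀ q → q ℚ.+ q ≡ (ℚ.1ℚ ℚ.+ ℚ.1ℚ) ℚ.* q
  double = solve 1 (λ q → q :+ q := (con ℚ.1ℚ :+ con ℚ.1ℚ) :* q) refl

sumℕ-cong : ∀ n {f g : ℕ → ℚ} → (∀ j → f j ≡ g j) → sumℕ n f ≡ sumℕ n g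
sumℕ-cong zero    f≡g = refl
sumℕ-cong (suc n) f≡g = cong₂ ℚ._+_ (sumℕ-cong n f≡g) (f≡g n)

sumℕ-zero : ∀ n {f : ℕ → ℚ} → (∀ j → f j ≡ ℚ.0ℚ) → sumℕ n f ≡ ℚ.0ℚ
sumℕ-zero zero    f≡0 = refl
sumℕ-zero (suc n) f≡0 = cong₂ ℚ._+_ (sumℕ-zero n f≡0) (f≡0 n)

sumℕ-sub : ∀ n (f g : ℕ → ℚ) → sumℕ n (λ j → f j ℚ.- g j) ≡ sumℕ n f ℚ.- sumℕ n g
sumℕ-sub zero    f g = refl
sumℕ-sub (suc n) f g = trans (cong (ℚ._+ (f n ℚ.- g n)) (sumℕ-sub n f g)) (interchange (sumℕ n f) (sumℕ n g) (f n) (g n))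
  where
  interchange : ∀ a b x y → (a ℚ.- b) ℚ.+ (x ℚ.- y) ≡ (a ℚ.+ x) ℚ.- (b ℚ.+ y)
  interchange = solve 4 (λ a b x y → (a :- b) :+ (x :- y) := (a :+ x) :- (b :+ y)) refl

sumℕ-suc : ∀ n (g : ℕ → ℚ) → sumℕ (suc n) g ≡ g 0 ℚ.+ sumℕ n (λ j → g (suc j))
sumℕ-suc zero    g = trans (ℚP.+-identityˡ (g 0)) (sym (ℚP.+-identityʳ (g 0)))
sumℕ-suc (suc n) g = trans (cong (ℚ._+ g (suc n)) (sumℕ-suc n g)) (ℚP.+-assoc (g 0) _ _)

m+1-1≡m : ∀ m → m ℤ.+ + 1 ℤ.- + 1 ≡ m
m+1-1≡m = solve-∀

module _ {f H : ℤ → ℚ} (f≡ΔH : ∀ b → f b ≡ H b ℚ.- H (b ℤ.- + 1)) where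

  sumFrom-telescoping : ∀ len m → sumFrom m len f ≡ H (m ℤ.+ + len ℤ.- + 1) ℚ.- H (m ℤ.- + 1)
  sumFrom-telescoping zero m = begin
    ℚ.0ℚ                                      ≡⟨ ℚP.+-inverseʳ (H (m ℤ.- + 1)) ⟨
    H (m ℤ.- + 1) ℚ.- H (m ℤ.- + 1)           ≡⟨ cong (λ i → H (i ℤ.- + 1) ℚ.- H (m ℤ.- + 1)) (ℤP.+-identityʳ m) ⟨
    H (m ℤ.+ + 0 ℤ.- + 1) ℚ.- H (m ℤ.- + 1)   ∎
    where open ≡-Reasoning
  sumFrom-telescoping (suc len) m = begin
    f m ℚ.+ sumFrom (m ℤ.+ + 1) len f
      ≡⟨ cong₂ ℚ._+_ (f≡ΔH m) (sumFrom-telescoping len (m ℤ.+ + 1)) ⟩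
    (H m ℚ.- H (m ℤ.- + 1)) ℚ.+ (H (m ℤ.+ + 1 ℤ.+ + len ℤ.- + 1) ℚ.- H (m ℤ.+ + 1 ℤ.- + 1))
      ≡⟨ cong₂ (λ i j → (H m ℚ.- H (m ℤ.- + 1)) ℚ.+ (H i ℚ.- H j)) (last m len) (m+1-1≡m m) ⟩
    (H m ℚ.- H (m ℤ.- + 1)) ℚ.+ (H (m ℤ.+ + suc len ℤ.- + 1) ℚ.- H m)
      ≡⟨ cancel (H m) (H (m ℤ.- + 1)) (H (m ℤ.+ + suc len ℤ.- + 1)) ⟩
    H (m ℤ.+ + suc len ℤ.- + 1) ℚ.- H (m ℤ.- + 1) ∎
    where
    open ≡-Reasoning
    last : ∀ m len → m ℤ.+ + 1 ℤ.+ + len ℤ.- + 1 ≡ m ℤ.+ + suc len ℤ.- + 1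
    last m len = trans (shift m (+ len)) (cong (λ l → m ℤ.+ l ℤ.- + 1) (sym (ℤP.pos-+ 1 len)))
      where
      shift : ∀ m l → m ℤ.+ + 1 ℤ.+ l ℤ.- + 1 ≡ m ℤ.+ (+ 1 ℤ.+ l) ℤ.- + 1
      shift = solve-∀
    cancel : ∀ a b c → (a ℚ.- b) ℚ.+ (c ℚ.- a) ≡ c ℚ.- b
    cancel = solve 3 (λ a b c → (a :- b) :+ (c :- a) := c :- b) refl

  -- The convention for empty and reversed ranges is exactly what makes this hold for all c and a.
  Σ-telescoping : ∀ c a → Σ[ c ⋯ a ] f ≡ H a ℚ.- H (c ℤ.- + 1)
  Σ-telescoping c a with a ℤ.- c ℤ.+ + 1 in eq
  ... | + len = trans (sumFrom-telescoping len c) (cong (λ i → H i ℚ.- H (c ℤ.- + 1)) top)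
    where
    top : c ℤ.+ + len ℤ.- + 1 ≡ a
    top = trans (cong (λ l → c ℤ.+ l ℤ.- + 1) (sym eq)) (collapse a c)
      where
      collapse : ∀ a c → c ℤ.+ (a ℤ.- c ℤ.+ + 1) ℤ.- + 1 ≡ a
      collapse = solve-∀
  ... | -[1+ k ] = begin
    ℚ.- sumFrom (a ℤ.+ + 1) (suc k) f
      ≡⟨ cong ℚ.-_ (sumFrom-telescoping (suc k) (a ℤ.+ + 1)) ⟩
    ℚ.- (H (a ℤ.+ + 1 ℤ.+ + suc k ℤ.- + 1) ℚ.- H (a ℤ.+ + 1 ℤ.- + 1))
      ≡⟨ cong₂ (λ i j → ℚ.- (H i ℚ.- H j)) top (m+1-1≡m a) ⟩
    ℚ.- (H (c ℤ.- + 1) ℚ.- H a)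
      ≡⟨ flip (H (c ℤ.- + 1)) (H a) ⟩
    H a ℚ.- H (c ℤ.- + 1) ∎
    where
    open ≡-Reasoning
    top : a ℤ.+ + 1 ℤ.+ + suc k ℤ.- + 1 ≡ c ℤ.- + 1
    top = trans (cong (λ l → a ℤ.+ + 1 ℤ.+ ℤ.- l ℤ.- + 1) (sym eq)) (collapse a c)
      where
      collapse : ∀ a c → a ℤ.+ + 1 ℤ.+ ℤ.- (a ℤ.- c ℤ.+ + 1) ℤ.- + 1 ≡ c ℤ.- + 1
      collapse = solve-∀
    flip : ∀ x y → ℚ.- (x ℚ.- y) ≡ y ℚ.- x
    flip = solve 2 (λ x y → :- (x :- y) := y :- x) refl

FibonacciRecurrence : (ℤ → ℤ) → Set
FibonacciRecurrence X = ∀ m → X (m ℤ.+ + 2) ≡ X (m ℤ.+ + 1) ℤ.+ X m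

F-recurrence : FibonacciRecurrence F
F-recurrence (+ k) rewrite ℕP.+-comm k 2 | ℕP.+-comm k 1 = refl
F-recurrence -[1+ 0 ] = refl
F-recurrence -[1+ 1 ] = refl
F-recurrence -[1+ suc (suc k) ] = negative (sgn k) (fibℕ (suc k)) (fibℕ (suc (suc k)))
  where
  negative : ∀ σ x y → σ ℤ.* x ≡ (ℤ.- σ) ℤ.* y ℤ.+ (ℤ.- (ℤ.- σ)) ℤ.* (y ℤ.+ x)
  negative = solve-∀

L-recurrence : FibonacciRecurrence L
L-recurrence (+ k) rewrite ℕP.+-comm k 2 | ℕP.+-comm k 1 = refl
L-recurrence -[1+ 0 ] = refl
L-recurrence -[1+ 1 ] = refl
L-recurrence -[1+ suc (suc k) ] = negative (sgn k) (lucℕ (suc k)) (lucℕ (suc (suc k)))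
  where
  negative : ∀ σ x y → (ℤ.- σ) ℤ.* x ≡ (ℤ.- (ℤ.- σ)) ℤ.* y ℤ.+ (ℤ.- (ℤ.- (ℤ.- σ))) ℤ.* (y ℤ.+ x)
  negative = solve-∀

module _ {X : ℤ → ℤ} (X-rec : FibonacciRecurrence X) where

  recurrence-skip : ∀ k → X (k ℤ.+ + 3) ℤ.+ X k ≡ X (k ℤ.+ + 2) ℤ.+ X (k ℤ.+ + 2)
  recurrence-skip k = begin
    X (k ℤ.+ + 3) ℤ.+ X k                           ≡⟨ cong (λ i → X i ℤ.+ X k) (k+3 k) ⟩
    X (k ℤ.+ + 1 ℤ.+ + 2) ℤ.+ X k                   ≡⟨ cong (ℤ._+ X k) (X-rec (k ℤ.+ + 1)) ⟩
    X (k ℤ.+ + 1 ℤ.+ + 1) ℤ.+ X (k ℤ.+ + 1) ℤ.+ X k ≡⟨ cong (λ i → X i ℤ.+ X (k ℤ.+ + 1) ℤ.+ X k) (k+2 k) ⟩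
    X (k ℤ.+ + 2) ℤ.+ X (k ℤ.+ + 1) ℤ.+ X k         ≡⟨ ℤP.+-assoc (X (k ℤ.+ + 2)) _ _ ⟩
    X (k ℤ.+ + 2) ℤ.+ (X (k ℤ.+ + 1) ℤ.+ X k)       ≡⟨ cong (λ y → X (k ℤ.+ + 2) ℤ.+ y) (X-rec k) ⟨
    X (k ℤ.+ + 2) ℤ.+ X (k ℤ.+ + 2)                 ∎
    where
    open ≡-Reasoning
    k+3 : ∀ k → k ℤ.+ + 3 ≡ k ℤ.+ + 1 ℤ.+ + 2
    k+3 = solve-∀
    k+2 : ∀ k → k ℤ.+ + 1 ℤ.+ + 1 ≡ k ℤ.+ + 2
    k+2 = solve-∀

negOnePow-suc : ∀ x → negOnePow (x ℤ.+ + 1) ≡ ℤ.- negOnePow x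
negOnePow-suc (+ k) rewrite ℕP.+-comm k 1 = refl
negOnePow-suc -[1+ 0 ] = refl
negOnePow-suc -[1+ suc k ] = sym (ℤP.neg-involutive (sgn (suc k)))

negOnePow-pred : ∀ x → negOnePow (x ℤ.- + 1) ≡ ℤ.- negOnePow x
negOnePow-pred x = begin
  negOnePow (x ℤ.- + 1)                    ≡⟨ ℤP.neg-involutive _ ⟨
  ℤ.- ℤ.- negOnePow (x ℤ.- + 1)            ≡⟨ cong ℤ.-_ (negOnePow-suc (x ℤ.- + 1)) ⟨
  ℤ.- negOnePow (x ℤ.- + 1 ℤ.+ + 1)        ≡⟨ cong (λ y → ℤ.- negOnePow y) (m-1+1≡m x) ⟩
  ℤ.- negOnePow x                          ∎
  where
  open ≡-Reasoning
  m-1+1≡m : ∀ m → m ℤ.- + 1 ℤ.+ + 1 ≡ m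
  m-1+1≡m = solve-∀

fallingℤ-suc : ∀ N j → fallingℤ (N ℤ.+ + 1) (suc j) ≡ (N ℤ.+ + 1) ℤ.* fallingℤ N j
fallingℤ-suc N zero = base N
  where
  base : ∀ N → + 1 ℤ.* (N ℤ.+ + 1 ℤ.- + 0) ≡ (N ℤ.+ + 1) ℤ.* + 1
  base = solve-∀
fallingℤ-suc N (suc j) = begin
  fallingℤ (N ℤ.+ + 1) (suc j) ℤ.* (N ℤ.+ + 1 ℤ.- + suc j)
    ≡⟨ cong₂ ℤ._*_ (fallingℤ-suc N j) (cong (λ i → N ℤ.+ + 1 ℤ.- i) (ℤP.pos-+ 1 j)) ⟩
  (N ℤ.+ + 1) ℤ.* fallingℤ N j ℤ.* (N ℤ.+ + 1 ℤ.- (+ 1 ℤ.+ + j))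
    ≡⟨ step N (fallingℤ N j) (+ j) ⟩
  (N ℤ.+ + 1) ℤ.* (fallingℤ N j ℤ.* (N ℤ.- + j)) ∎
  where
  open ≡-Reasoning
  step : ∀ N f J → (N ℤ.+ + 1) ℤ.* f ℤ.* (N ℤ.+ + 1 ℤ.- (+ 1 ℤ.+ J)) ≡ (N ℤ.+ + 1) ℤ.* (f ℤ.* (N ℤ.- J))
  step = solve-∀

fallingℤ-diff : ∀ N j → fallingℤ (N ℤ.+ + 1) (suc j) ℤ.- fallingℤ N (suc j) ≡ + suc j ℤ.* fallingℤ N j
fallingℤ-diff N j = begin
  fallingℤ (N ℤ.+ + 1) (suc j) ℤ.- fallingℤ N j ℤ.* (N ℤ.- + j)
    ≡⟨ cong (ℤ._- fallingℤ N j ℤ.* (N ℤ.- + j)) (fallingℤ-suc N j) ⟩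
  (N ℤ.+ + 1) ℤ.* fallingℤ N j ℤ.- fallingℤ N j ℤ.* (N ℤ.- + j)
    ≡⟨ collect N (fallingℤ N j) (+ j) ⟩
  (+ 1 ℤ.+ + j) ℤ.* fallingℤ N j
    ≡⟨ cong (ℤ._* fallingℤ N j) (ℤP.pos-+ 1 j) ⟨
  + suc j ℤ.* fallingℤ N j ∎
  where
  open ≡-Reasoning
  collect : ∀ N f J → (N ℤ.+ + 1) ℤ.* f ℤ.- f ℤ.* (N ℤ.- J) ≡ (+ 1 ℤ.+ J) ℤ.* f
  collect = solve-∀

binom-pascal : ∀ N j → binom N j ≡ binom (N ℤ.+ + 1) (suc j) ℚ.- binom N (suc j)
binom-pascal N j = sym (begin
  binom (N ℤ.+ + 1) (suc j) ℚ.- binom N (suc j)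
    ≡⟨ cong₂ ℚ._-_ (ι-/ℕ f₁ (suc j !) {{suc j !≢0}}) (ι-/ℕ f₀ (suc j !) {{suc j !≢0}}) ⟨
  (ι f₁ /ℕ (suc j !)) {{suc j !≢0}} ℚ.- (ι f₀ /ℕ (suc j !)) {{suc j !≢0}}
    ≡⟨ ι-sub-/ℕ f₁ f₀ (suc j !) {{suc j !≢0}} ⟩
  (ι (f₁ ℤ.- f₀) /ℕ (suc j !)) {{suc j !≢0}}
    ≡⟨ cong (λ z → (ι z /ℕ (suc j !)) {{suc j !≢0}}) (fallingℤ-diff N j) ⟩
  (ι (+ suc j ℤ.* fallingℤ N j) /ℕ (suc j !)) {{suc j !≢0}}
    ≡⟨ cong (λ q → (q /ℕ (suc j !)) {{suc j !≢0}}) (ι-* (+ suc j) (fallingℤ N j)) ⟩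
  ((ι (+ suc j) ℚ.* ι (fallingℤ N j)) /ℕ (suc j !)) {{suc j !≢0}}
    ≡⟨ *-/ℕ-cancelˡ (suc j) (j !) (ι (fallingℤ N j)) {{_}} {{j !≢0}} ⟩
  (ι (fallingℤ N j) /ℕ (j !)) {{j !≢0}}
    ≡⟨ ι-/ℕ (fallingℤ N j) (j !) {{j !≢0}} ⟩
  binom N j ∎)
  where
  open ≡-Reasoning
  f₁ = fallingℤ (N ℤ.+ + 1) (suc j)
  f₀ = fallingℤ N (suc j)

binom-vanishes : ∀ j → binom (+ j) (suc j) ≡ ℚ.0ℚ
binom-vanishes j = begin
  binom (+ j) (suc j)                     ≡⟨ cong (λ z → over (fallingℤ (+ j) j ℤ.* z)) (ℤP.+-inverseʳ (+ j)) ⟩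
  over (fallingℤ (+ j) j ℤ.* + 0)         ≡⟨ cong over (ℤP.*-zeroʳ (fallingℤ (+ j) j)) ⟩
  over (+ 0)                              ≡⟨ ℚP.0/n≡0 (suc j !) {{suc j !≢0}} ⟩
  ℚ.0ℚ                                    ∎
  where
  open ≡-Reasoning
  over : ℤ → ℚ
  over z = (z ℚ./ (suc j !)) {{suc j !≢0}}

module ClosedForm (X : ℤ → ℤ) (X-rec : FibonacciRecurrence X) (s c : ℤ) where

  summand : ℤ → ℚ
  summand a = ι (negOnePow a ℤ.* X (+ 3 ℤ.* a ℤ.+ s))

  leading : ℕ → ℤ → ℚ
  leading n a = ι (negOnePow a ℤ.* X (+ n ℤ.+ + 3 ℤ.* a ℤ.+ s)) /2^ n

  coeff : ℕ → ℕ → ℚ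
  coeff n j = ι (X (+ (n ∸ j) ℤ.+ + 3 ℤ.* (c ℤ.- + 1) ℤ.+ s)) /2^ (n ∸ j)

  correction : ℕ → ℤ → ℚ
  correction n a = sumℕ n (λ j → coeff n j ℚ.* binom (a ℤ.+ + j ℤ.- c) j)

  closedForm : ℕ → ℤ → ℚ
  closedForm n a = leading n a ℚ.+ ι (negOnePow c) ℚ.* correction n a

  shiftedCorrection : ℕ → ℤ → ℚ
  shiftedCorrection n a = sumℕ n (λ j → coeff n j ℚ.* binom (a ℤ.+ + suc j ℤ.- c) (suc j))

  antidifference : ℕ → ℤ → ℚ
  antidifference n a = leading (suc n) a ℚ.+ ι (negOnePow c) ℚ.* shiftedCorrection n a

  leading-numerator-diff : ∀ n b →
    negOnePow b ℤ.* X (+ suc n ℤ.+ + 3 ℤ.* b ℤ.+ s)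
      ℤ.- negOnePow (b ℤ.- + 1) ℤ.* X (+ suc n ℤ.+ + 3 ℤ.* (b ℤ.- + 1) ℤ.+ s)
    ≡ negOnePow b ℤ.* X (+ n ℤ.+ + 3 ℤ.* b ℤ.+ s) ℤ.+ negOnePow b ℤ.* X (+ n ℤ.+ + 3 ℤ.* b ℤ.+ s)
  leading-numerator-diff n b = begin
    σ ℤ.* X (+ suc n ℤ.+ + 3 ℤ.* b ℤ.+ s) ℤ.- negOnePow (b ℤ.- + 1) ℤ.* X (+ suc n ℤ.+ + 3 ℤ.* (b ℤ.- + 1) ℤ.+ s)
      ≡⟨ cong₂ (λ i j → σ ℤ.* X i ℤ.- negOnePow (b ℤ.- + 1) ℤ.* X j) upper lower ⟩
    σ ℤ.* X (k ℤ.+ + 3) ℤ.- negOnePow (b ℤ.- + 1) ℤ.* X k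
      ≡⟨ cong (λ τ → σ ℤ.* X (k ℤ.+ + 3) ℤ.- τ ℤ.* X k) (negOnePow-pred b) ⟩
    σ ℤ.* X (k ℤ.+ + 3) ℤ.- (ℤ.- σ) ℤ.* X k
      ≡⟨ factor σ (X (k ℤ.+ + 3)) (X k) ⟩
    σ ℤ.* (X (k ℤ.+ + 3) ℤ.+ X k)
      ≡⟨ cong (σ ℤ.*_) (recurrence-skip {X} X-rec k) ⟩
    σ ℤ.* (X (k ℤ.+ + 2) ℤ.+ X (k ℤ.+ + 2))
      ≡⟨ ℤP.*-distribˡ-+ σ (X (k ℤ.+ + 2)) (X (k ℤ.+ + 2)) ⟩
    σ ℤ.* X (k ℤ.+ + 2) ℤ.+ σ ℤ.* X (k ℤ.+ + 2)
      ≡⟨ cong (λ i → σ ℤ.* X i ℤ.+ σ ℤ.* X i) middle ⟩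
    σ ℤ.* X m ℤ.+ σ ℤ.* X m ∎
    where
    open ≡-Reasoning
    σ = negOnePow b
    m = + n ℤ.+ + 3 ℤ.* b ℤ.+ s
    k = m ℤ.- + 2
    index₁ : ∀ N b s → (+ 1 ℤ.+ N) ℤ.+ + 3 ℤ.* b ℤ.+ s ≡ (N ℤ.+ + 3 ℤ.* b ℤ.+ s ℤ.- + 2) ℤ.+ + 3
    index₁ = solve-∀
    index₂ : ∀ N b s → (+ 1 ℤ.+ N) ℤ.+ + 3 ℤ.* (b ℤ.- + 1) ℤ.+ s ≡ N ℤ.+ + 3 ℤ.* b ℤ.+ s ℤ.- + 2
    index₂ = solve-∀
    index₃ : ∀ m → m ℤ.- + 2 ℤ.+ + 2 ≡ m
    index₃ = solve-∀
    upper : + suc n ℤ.+ + 3 ℤ.* b ℤ.+ s ≡ k ℤ.+ + 3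
    upper = trans (cong (λ N → N ℤ.+ + 3 ℤ.* b ℤ.+ s) (ℤP.pos-+ 1 n)) (index₁ (+ n) b s)
    lower : + suc n ℤ.+ + 3 ℤ.* (b ℤ.- + 1) ℤ.+ s ≡ k
    lower = trans (cong (λ N → N ℤ.+ + 3 ℤ.* (b ℤ.- + 1) ℤ.+ s) (ℤP.pos-+ 1 n)) (index₂ (+ n) b s)
    middle : k ℤ.+ + 2 ≡ m
    middle = index₃ m
    factor : ∀ σ x y → σ ℤ.* x ℤ.- (ℤ.- σ) ℤ.* y ≡ σ ℤ.* (x ℤ.+ y)
    factor = solve-∀

  leading-telescopes : ∀ n b → leading n b ≡ leading (suc n) b ℚ.- leading (suc n) (b ℤ.- + 1)
  leading-telescopes n b = begin
    ι u /2^ n                                  ≡⟨ /2^-suc (ι u) n ⟩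
    (ι u ℚ.+ ι u) /2^ suc n                    ≡⟨ cong (_/2^ suc n) (ι-+ u u) ⟨
    ι (u ℤ.+ u) /2^ suc n                      ≡⟨ cong (λ z → ι z /2^ suc n) (leading-numerator-diff n b) ⟨
    ι (v ℤ.- w) /2^ suc n                      ≡⟨ ι-sub-/ℕ v w (2 ℕ.^ suc n) {{m^n≢0 2 (suc n)}} ⟨
    leading (suc n) b ℚ.- leading (suc n) (b ℤ.- + 1) ∎
    where
    open ≡-Reasoning
    u = negOnePow b ℤ.* X (+ n ℤ.+ + 3 ℤ.* b ℤ.+ s)
    v = negOnePow b ℤ.* X (+ suc n ℤ.+ + 3 ℤ.* b ℤ.+ s)
    w = negOnePow (b ℤ.- + 1) ℤ.* X (+ suc n ℤ.+ + 3 ℤ.* (b ℤ.- + 1) ℤ.+ s)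

  correction-telescopes : ∀ n b → correction n b ≡ shiftedCorrection n b ℚ.- shiftedCorrection n (b ℤ.- + 1)
  correction-telescopes n b = trans (sumℕ-cong n pascal-term) (sumℕ-sub n _ _)
    where
    open ≡-Reasoning
    index₁ : ∀ b J c → b ℤ.+ J ℤ.- c ℤ.+ + 1 ≡ b ℤ.+ (+ 1 ℤ.+ J) ℤ.- c
    index₁ = solve-∀
    index₂ : ∀ b J c → b ℤ.+ J ℤ.- c ≡ b ℤ.- + 1 ℤ.+ (+ 1 ℤ.+ J) ℤ.- c
    index₂ = solve-∀
    distrib : ∀ t x y → t ℚ.* (x ℚ.- y) ≡ t ℚ.* x ℚ.- t ℚ.* y
    distrib = solve 3 (λ t x y → t :* (x :- y) := t :* x :- t :* y) refl
    pascal-term : ∀ j → coeff n j ℚ.* binom (b ℤ.+ + j ℤ.- c) j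
      ≡ coeff n j ℚ.* binom (b ℤ.+ + suc j ℤ.- c) (suc j) ℚ.- coeff n j ℚ.* binom (b ℤ.- + 1 ℤ.+ + suc j ℤ.- c) (suc j)
    pascal-term j = begin
      coeff n j ℚ.* binom N j
        ≡⟨ cong (coeff n j ℚ.*_) (binom-pascal N j) ⟩
      coeff n j ℚ.* (binom (N ℤ.+ + 1) (suc j) ℚ.- binom N (suc j))
        ≡⟨ cong₂ (λ x y → coeff n j ℚ.* (binom x (suc j) ℚ.- binom y (suc j))) upper lower ⟩
      coeff n j ℚ.* (binom (b ℤ.+ + suc j ℤ.- c) (suc j) ℚ.- binom (b ℤ.- + 1 ℤ.+ + suc j ℤ.- c) (suc j))
        ≡⟨ distrib (coeff n j) _ _ ⟩
      coeff n j ℚ.* binom (b ℤ.+ + suc j ℤ.- c) (suc j) ℚ.- coeff n j ℚ.* binom (b ℤ.- + 1 ℤ.+ + suc j ℤ.- c) (suc j) ∎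
      where
      N = b ℤ.+ + j ℤ.- c
      upper : N ℤ.+ + 1 ≡ b ℤ.+ + suc j ℤ.- c
      upper = trans (index₁ b (+ j) c) (cong (λ J → b ℤ.+ J ℤ.- c) (sym (ℤP.pos-+ 1 j)))
      lower : N ≡ b ℤ.- + 1 ℤ.+ + suc j ℤ.- c
      lower = trans (index₂ b (+ j) c) (cong (λ J → b ℤ.- + 1 ℤ.+ J ℤ.- c) (sym (ℤP.pos-+ 1 j)))

  closedForm-telescopes : ∀ n b → closedForm n b ≡ antidifference n b ℚ.- antidifference n (b ℤ.- + 1)
  closedForm-telescopes n b =
    trans (cong₂ (λ x y → x ℚ.+ ι (negOnePow c) ℚ.* y) (leading-telescopes n b) (correction-telescopes n b))
          (interchange (leading (suc n) b) (leading (suc n) (b ℤ.- + 1)) (ι (negOnePow c))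
                       (shiftedCorrection n b) (shiftedCorrection n (b ℤ.- + 1)))
    where
    interchange : ∀ a a′ κ x x′ → (a ℚ.- a′) ℚ.+ κ ℚ.* (x ℚ.- x′) ≡ (a ℚ.+ κ ℚ.* x) ℚ.- (a′ ℚ.+ κ ℚ.* x′)
    interchange = solve 5 (λ a a′ κ x x′ → (a :- a′) :+ κ :* (x :- x′) := (a :+ κ :* x) :- (a′ :+ κ :* x′)) refl

  leading-below-c : ∀ n → leading (suc n) (c ℤ.- + 1) ≡ ℚ.- (ι (negOnePow c) ℚ.* coeff (suc n) 0)
  leading-below-c n = begin
    ι (negOnePow (c ℤ.- + 1) ℤ.* Y) /2^ suc n    ≡⟨ cong (λ σ → ι (σ ℤ.* Y) /2^ suc n) (negOnePow-pred c) ⟩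
    ι (ℤ.- negOnePow c ℤ.* Y) /2^ suc n          ≡⟨ cong (_/2^ suc n) (ι-* (ℤ.- negOnePow c) Y) ⟩
    (ι (ℤ.- negOnePow c) ℚ.* ι Y) /2^ suc n      ≡⟨ cong (λ κ → (κ ℚ.* ι Y) /2^ suc n) (ι-neg (negOnePow c)) ⟩
    (ℚ.- ι (negOnePow c) ℚ.* ι Y) /2^ suc n      ≡⟨ reassoc (ι (negOnePow c)) (ι Y) _ ⟩
    ℚ.- (ι (negOnePow c) ℚ.* (ι Y /2^ suc n))    ∎
    where
    open ≡-Reasoning
    Y = X (+ suc n ℤ.+ + 3 ℤ.* (c ℤ.- + 1) ℤ.+ s)
    reassoc : ∀ κ y r → (ℚ.- κ ℚ.* y) ℚ.* r ≡ ℚ.- (κ ℚ.* (y ℚ.* r))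
    reassoc = solve 3 (λ κ y r → (:- κ :* y) :* r := :- (κ :* (y :* r))) refl

  shiftedCorrection-below-c : ∀ n → shiftedCorrection n (c ℤ.- + 1) ≡ ℚ.0ℚ
  shiftedCorrection-below-c n = sumℕ-zero n λ j → begin
    coeff n j ℚ.* binom (c ℤ.- + 1 ℤ.+ + suc j ℤ.- c) (suc j)   ≡⟨ cong (λ N → coeff n j ℚ.* binom N (suc j)) (index j) ⟩
    coeff n j ℚ.* binom (+ j) (suc j)                           ≡⟨ cong (coeff n j ℚ.*_) (binom-vanishes j) ⟩
    coeff n j ℚ.* ℚ.0ℚ                                          ≡⟨ ℚP.*-zeroʳ (coeff n j) ⟩
    ℚ.0ℚ                                                        ∎
    where
    open ≡-Reasoning
    collapse : ∀ c J → c ℤ.- + 1 ℤ.+ (+ 1 ℤ.+ J) ℤ.- c ≡ J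
    collapse = solve-∀
    index : ∀ j → c ℤ.- + 1 ℤ.+ + suc j ℤ.- c ≡ + j
    index j = trans (cong (λ J → c ℤ.- + 1 ℤ.+ J ℤ.- c) (ℤP.pos-+ 1 j)) (collapse c (+ j))

  antidifference-below-c : ∀ n → antidifference n (c ℤ.- + 1) ≡ ℚ.- (ι (negOnePow c) ℚ.* coeff (suc n) 0)
  antidifference-below-c n = begin
    leading (suc n) (c ℤ.- + 1) ℚ.+ κ ℚ.* shiftedCorrection n (c ℤ.- + 1)
      ≡⟨ cong₂ (λ x y → x ℚ.+ κ ℚ.* y) (leading-below-c n) (shiftedCorrection-below-c n) ⟩
    ℚ.- (κ ℚ.* coeff (suc n) 0) ℚ.+ κ ℚ.* ℚ.0ℚ
      ≡⟨ cong (λ y → ℚ.- (κ ℚ.* coeff (suc n) 0) ℚ.+ y) (ℚP.*-zeroʳ κ) ⟩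
    ℚ.- (κ ℚ.* coeff (suc n) 0) ℚ.+ ℚ.0ℚ
      ≡⟨ ℚP.+-identityʳ _ ⟩
    ℚ.- (κ ℚ.* coeff (suc n) 0) ∎
    where
    open ≡-Reasoning
    κ = ι (negOnePow c)

  antidifference-from-c : ∀ n a → antidifference n a ℚ.- antidifference n (c ℤ.- + 1) ≡ closedForm (suc n) a
  antidifference-from-c n a = begin
    antidifference n a ℚ.- antidifference n (c ℤ.- + 1)
      ≡⟨ cong (λ y → antidifference n a ℚ.- y) (antidifference-below-c n) ⟩
    (leading (suc n) a ℚ.+ κ ℚ.* shiftedCorrection n a) ℚ.- ℚ.- (κ ℚ.* coeff (suc n) 0)
      ≡⟨ collect (leading (suc n) a) κ (shiftedCorrection n a) (coeff (suc n) 0) ⟩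
    leading (suc n) a ℚ.+ κ ℚ.* (coeff (suc n) 0 ℚ.* ℚ.1ℚ ℚ.+ shiftedCorrection n a)
      ≡⟨ cong (λ t → leading (suc n) a ℚ.+ κ ℚ.* t) (sumℕ-suc n _) ⟨
    closedForm (suc n) a ∎
    where
    open ≡-Reasoning
    κ = ι (negOnePow c)
    collect : ∀ ℓ κ S t → (ℓ ℚ.+ κ ℚ.* S) ℚ.- ℚ.- (κ ℚ.* t) ≡ ℓ ℚ.+ κ ℚ.* (t ℚ.* ℚ.1ℚ ℚ.+ S)
    collect = solve 4 (λ ℓ κ S t → (ℓ :+ κ :* S) :- :- (κ :* t) := ℓ :+ κ :* (t :* con ℚ.1ℚ :+ S)) refl

  summand≡closedForm₀ : ∀ a → summand a ≡ closedForm 0 a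
  summand≡closedForm₀ a = begin
    ι (negOnePow a ℤ.* X (+ 3 ℤ.* a ℤ.+ s))          ≡⟨ cong (λ i → ι (negOnePow a ℤ.* X (i ℤ.+ s))) (ℤP.+-identityˡ (+ 3 ℤ.* a)) ⟨
    ι (negOnePow a ℤ.* X (+ 0 ℤ.+ + 3 ℤ.* a ℤ.+ s))  ≡⟨ pad _ (ι (negOnePow c)) ⟩
    closedForm 0 a                                   ∎
    where
    open ≡-Reasoning
    pad : ∀ x κ → x ≡ x ℚ.* ℚ.1ℚ ℚ.+ κ ℚ.* ℚ.0ℚ
    pad = solve 2 (λ x κ → x := x :* con ℚ.1ℚ :+ κ :* con ℚ.0ℚ) refl

  iterSum≡closedForm : ∀ n a → iterSum summand c n a ≡ closedForm n a
  iterSum≡closedForm zero    a = summand≡closedForm₀ a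
  iterSum≡closedForm (suc n) a = begin
    Σ[ c ⋯ a ] (iterSum summand c n)                      ≡⟨ Σ-telescoping {H = antidifference n} step c a ⟩
    antidifference n a ℚ.- antidifference n (c ℤ.- + 1)   ≡⟨ antidifference-from-c n a ⟩
    closedForm (suc n) a                                  ∎
    where
    open ≡-Reasoning
    step : ∀ b → iterSum summand c n b ≡ antidifference n b ℚ.- antidifference n (b ℤ.- + 1)
    step b = trans (iterSum≡closedForm n b) (closedForm-telescopes n b)

-- The identity also holds for n = 0.
theorem2 : (aₙ s c : ℤ) (n : ℕ) → 0 ℕ.< n →
    (iterSum (λ a₀ → ι (negOnePow a₀ ℤ.* F (+ 3 ℤ.* a₀ ℤ.+ s))) c n aₙ
      ≡ (ι (negOnePow aₙ ℤ.* F (+ n ℤ.+ + 3 ℤ.* aₙ ℤ.+ s)) /2^ n)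
        ℚ.+ ι (negOnePow c) ℚ.* sumℕ n (λ j →
              (ι (F (+ (n ∸ j) ℤ.+ + 3 ℤ.* (c ℤ.- + 1) ℤ.+ s)) /2^ (n ∸ j))
                ℚ.* binom (aₙ ℤ.+ + j ℤ.- c) j))
    × (iterSum (λ a₀ → ι (negOnePow a₀ ℤ.* L (+ 3 ℤ.* a₀ ℤ.+ s))) c n aₙ
      ≡ (ι (negOnePow aₙ ℤ.* L (+ n ℤ.+ + 3 ℤ.* aₙ ℤ.+ s)) /2^ n)
        ℚ.+ ι (negOnePow c) ℚ.* sumℕ n (λ j →
              (ι (L (+ (n ∸ j) ℤ.+ + 3 ℤ.* (c ℤ.- + 1) ℤ.+ s)) /2^ (n ∸ j))
                ℚ.* binom (aₙ ℤ.+ + j ℤ.- c) j))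
theorem2 aₙ s c n _ =
  ClosedForm.iterSum≡closedForm F F-recurrence s c n aₙ ,
  ClosedForm.iterSum≡closedForm L L-recurrence s c n aₙ
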